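{- For each integer $d\ge 0$, there exist $4^{d+1}$ pairwise disjoint Breaker pairing strategies for $\mathcal{Q}(4^{d+1},4^d+1)$, all of the same cardinality, whose union is the set of all edges of $Q_{4^{d+1}}$.
   Context: $Q_n$ is the hypercube graph on $\{0,1\}^n$ (vertices adjacent iff they differ in exactly one coordinate). A $k$-dimensional subcube of $Q_n$ is obtained by choosing $n-k$ coordinates and fixed values in $\{0,1\}$ for them, and taking all $2^k$ vectors agreeing with these fixed values. $\mathcal{Q}(n,k)$ is the hypergraph with vertex set $\{0,1\}^n$ whose edges are the $k$-dimensional subcubes of $Q_n$ (the Maker–Breaker game is played on it). Following the paper's convention, a Breaker pairing strategy for $\mathcal{Q}(n,k)$ is a matching $M$ in $Q_n$ (a set of pairwise disjoint edges) such that every $k$-dimensional subcube of $Q_n$ contains both endpoints of at least one edge of $M$. -}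

module Defs where

open import Data.Nat using (ℕ)
open import Data.Bool using (Bool; true; false; not)
open import Data.Fin using (Fin)
open import Data.Fin.Subset using (Subset; ∣_∣; _∈_; _∉_)
open import Data.Vec using (Vec; lookup; updateAt)
open import Data.Product using (Σ; _×_; _,_; proj₁; proj₂; ∃)
open import Data.List using (List; length)
import Data.List.Membership.Propositional as LM
open import Data.List.Relation.Unary.Unique.Propositional using (Unique)
open import Relation.Binary.PropositionalEquality using (_≡_; _≢_)
open import Relation.Nullary using (¬_)

-- Vertices of Q_n: vectors in {0,1}^n (false = 0, true = 1).
Vertex : ℕ → Set
Vertex n = Vec Bool n

flipAt : ∀ {n} → Vertex n → Fin n → Vertex n
flipAt x i = updateAt x i not

-- An edge of Q_n, represented canonically by its lower endpoint x and
-- direction i with x_i = 0; its endpoints are x and x with coordinate i flipped.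
-- Every edge of Q_n has exactly one such representation.
record Edge (n : ℕ) : Set where
  constructor edge
  field
    low    : Vertex n
    dir    : Fin n
    lowDir : lookup low dir ≡ false

open Edge public

high : ∀ {n} → Edge n → Vertex n
high e = flipAt (low e) (dir e)

_isEndpointOf_ : ∀ {n} → Vertex n → Edge n → Set
v isEndpointOf e = (v ≡ low e) Data.Sum.⊎ (v ≡ high e)
  where import Data.Sum

-- A k-dimensional subcube: a set of free coordinates of size k together with
-- values (a base vector) on the remaining n - k fixed coordinates.
record Subcube (n k : ℕ) : Set where
  constructor subcube
  field
    free     : Subset n
    freeSize : ∣ free ∣ ≡ k
    base     : Vertex n

_∈Cube_ : ∀ {n k} → Vertex n → Subcube n k → Set
v ∈Cube C = ∀ i → i ∉ Subcube.free C → lookup v i ≡ lookup (Subcube.base C) i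

_⊆Cube_ : ∀ {n k} → Edge n → Subcube n k → Set
e ⊆Cube C = (low e ∈Cube C) × (high e ∈Cube C)

IsMatching : ∀ {n} → List (Edge n) → Set
IsMatching {n} M =
  Unique M ×
  (∀ e f → e LM.∈ M → f LM.∈ M → e ≢ f → ∀ (v : Vertex n) → v isEndpointOf e → ¬ (v isEndpointOf f))

IsPairingStrategy : (n k : ℕ) → List (Edge n) → Set
IsPairingStrategy n k M =
  IsMatching M × (∀ (C : Subcube n k) → ∃ λ e → e LM.∈ M × e ⊆Cube C)

module Submission where

-- Index the 4^D coordinates of the cube by 𝔽₄^D and give the edge in direction j at a vertex x
-- the colour ω^|x| j + ω² σ(x), where σ(x) is the sum of the indices of the 1-coordinates of x.
-- Since 1 + ω + ω² = 0 both endpoints of an edge give it the same colour, and at a fixed vertex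
-- the colour is a bijective function of the direction, so the 4^D colour classes are perfect
-- matchings partitioning the edges.  A subcube with base b and free coordinates S contains an
-- edge of colour c as soon as c = ω^(|b|+|L|) x + ω² (σ(b) + ΣL) for some x ∈ S and some list L
-- of elements of S, and if |S| > 4^(D-1) every c arises.  This is proved by induction on D,
-- splitting off the first coordinate of 𝔽₄^D.  If the set T of tails of S has more than half of
-- 4^(D-1) elements, T meets each of its translates, which lets two toggles fix the tail, while two
-- elements of S with the same tail fix the head.  Otherwise three elements of S share a tail, and
-- |T| > 4^(D-2) since each tail has at most four heads; the induction hypothesis for T is then
-- corrected in the head by toggling pairs of those three elements.

open import Defs
open import Data.Nat using (ℕ; zero; suc; _+_; _*_; _^_; _≤_; _<_; _<?_; z≤n; s≤s)
import Data.Nat.Properties as ℕ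
open import Data.Bool using (Bool; true; false; not; _xor_; if_then_else_)
import Data.Bool as Bool
open import Data.Bool.Properties using (not-involutive; not-distribˡ-xor; not-distribʳ-xor; ¬-not)
open import Data.Fin using (Fin; zero; suc)
import Data.Fin as Fin
import Data.Fin.Properties as Finₚ
import Data.Fin.Subset as Subset
open import Data.List using (List; []; _∷_; map; foldr; filter; length; deduplicate; cartesianProductWith)
open import Data.List.Properties using (length-++; length-map; map-∘; map-cong; map-id; map-id-local; filter-notAll)
open import Data.List.Membership.Propositional using (_∈_; find; lose)
open import Data.List.Membership.Propositional.Properties
  using (∈-map⁺; ∈-map⁻; ∈-filter⁺; ∈-filter⁻; ∈-deduplicate⁺; ∈-deduplicate⁻; ∈-cartesianProductWith⁺)
import Data.List.Membership.DecPropositional as DecMembership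
open import Data.List.Relation.Binary.Subset.Propositional using (_⊆_)
open import Data.List.Relation.Unary.All as All using (All; []; _∷_; all?)
import Data.List.Relation.Unary.All.Properties as Allₚ
open import Data.List.Relation.Unary.Any as Any using (any?; here; there)
open import Data.List.Relation.Unary.AllPairs using ([]; _∷_)
open import Data.List.Relation.Unary.Unique.Propositional using (Unique)
open import Data.List.Relation.Unary.Unique.Propositional.Properties
  using (map⁺; map⁻; filter⁺; ++⁺; cartesianProductWith⁺)
open import Data.List.Relation.Unary.Unique.DecPropositional.Properties using (deduplicate-!)
open import Data.Product using (Σ; ∃; ∃₂; _×_; _,_; proj₁; proj₂)
open import Data.Sum using (inj₁; inj₂)
open import Data.Vec using (Vec; []; _∷_; head; tail; zipWith; replicate; lookup)
import Data.Vec as Vec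
import Data.Vec.Properties as Vecₚ
open import Function using (_∘_; case_of_)
open import Axiom.UniquenessOfIdentityProofs using (module Decidable⇒UIP)
open import Relation.Binary.Definitions using (DecidableEquality)
open import Relation.Binary.PropositionalEquality
open import Relation.Nullary using (Dec; yes; no; ¬_; ¬?; contradiction)
open import Relation.Nullary.Decidable using (map′; from-yes; _→-dec_)
open import Relation.Unary using (Decidable)

module Exhaustive {A : Set} (elements : List A) (complete : ∀ a → a ∈ elements) where

  ∀? : {P : A → Set} → Decidable P → Dec (∀ a → P a)
  ∀? P? = map′ (λ ps a → All.lookup ps (complete a)) (λ ps → All.tabulate λ {a} _ → ps a) (all? P? elements)

  ∃? : {P : A → Set} → Decidable P → Dec (∃ P)
  ∃? P? = map′ Any.satisfied (λ (a , pa) → lose (complete a) pa) (any? P? elements)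

vectors : ∀ {A : Set} → List A → ∀ n → List (Vec A n)
vectors as zero    = [] ∷ []
vectors as (suc n) = cartesianProductWith _∷_ as (vectors as n)

∈-vectors : ∀ {A : Set} {as : List A} → (∀ a → a ∈ as) → ∀ {n} (v : Vec A n) → v ∈ vectors as n
∈-vectors complete []      = here refl
∈-vectors complete (a ∷ v) = ∈-cartesianProductWith⁺ _∷_ (complete a) (∈-vectors complete v)

vectors⁺ : ∀ {A : Set} {as : List A} → Unique as → ∀ n → Unique (vectors as n)
vectors⁺ as! zero    = [] ∷ []
vectors⁺ as! (suc n) = cartesianProductWith⁺ _∷_ Vecₚ.∷-injective as! (vectors⁺ as! n)

length-cartesianProductWith : ∀ {A B C : Set} (f : A → B → C) xs ys →
  length (cartesianProductWith f xs ys) ≡ length xs * length ys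
length-cartesianProductWith f []       ys = refl
length-cartesianProductWith f (x ∷ xs) ys =
  trans (length-++ (map (f x) ys)) (cong₂ _+_ (length-map (f x) ys) (length-cartesianProductWith f xs ys))

length-vectors : ∀ {A : Set} (as : List A) n → length (vectors as n) ≡ length as ^ n
length-vectors as zero    = refl
length-vectors as (suc n) =
  trans (length-cartesianProductWith _∷_ as (vectors as n)) (cong (length as *_) (length-vectors as n))

Bool-elements : List Bool
Bool-elements = true ∷ false ∷ []

Bool-elements! : Unique Bool-elements
Bool-elements! = ((λ ()) ∷ []) ∷ [] ∷ []

∈-Bool-elements : ∀ b → b ∈ Bool-elements
∈-Bool-elements true  = here refl
∈-Bool-elements false = there (here refl)

-- The field 𝔽₄ = {0, 1, ω, ω²}

data 𝔽₄ : Set where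
  0# 1# ω ω² : 𝔽₄

infixl 6 _+ᶠ_
_+ᶠ_ : 𝔽₄ → 𝔽₄ → 𝔽₄
0# +ᶠ b  = b
a  +ᶠ 0# = a
1# +ᶠ 1# = 0#
1# +ᶠ ω  = ω²
1# +ᶠ ω² = ω
ω  +ᶠ 1# = ω²
ω  +ᶠ ω  = 0#
ω  +ᶠ ω² = 1#
ω² +ᶠ 1# = ω
ω² +ᶠ ω  = 1#
ω² +ᶠ ω² = 0#

ω·ᶠ_ : 𝔽₄ → 𝔽₄
ω·ᶠ 0# = 0#
ω·ᶠ 1# = ω
ω·ᶠ ω  = ω²
ω·ᶠ ω² = 1#

ω²·ᶠ_ : 𝔽₄ → 𝔽₄
ω²·ᶠ a = ω·ᶠ (ω·ᶠ a)

ω^[_]·ᶠ_ : Bool → 𝔽₄ → 𝔽₄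
ω^[ false ]·ᶠ a = a
ω^[ true  ]·ᶠ a = ω·ᶠ a

[_]ᶠ_ : Bool → 𝔽₄ → 𝔽₄
[ r ]ᶠ a = if r then a else 0#

colourᶠ : Bool → 𝔽₄ → 𝔽₄ → 𝔽₄
colourᶠ p s j = ω^[ p ]·ᶠ j +ᶠ ω²·ᶠ s

toFin : 𝔽₄ → Fin 4
toFin 0# = zero
toFin 1# = suc zero
toFin ω  = suc (suc zero)
toFin ω² = suc (suc (suc zero))

fromFin : Fin 4 → 𝔽₄
fromFin zero                   = 0#
fromFin (suc zero)             = 1#
fromFin (suc (suc zero))       = ω
fromFin (suc (suc (suc zero))) = ω²

fromFin-toFin : ∀ a → fromFin (toFin a) ≡ a
fromFin-toFin 0# = refl
fromFin-toFin 1# = refl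
fromFin-toFin ω  = refl
fromFin-toFin ω² = refl

toFin-fromFin : ∀ i → toFin (fromFin i) ≡ i
toFin-fromFin zero                   = refl
toFin-fromFin (suc zero)             = refl
toFin-fromFin (suc (suc zero))       = refl
toFin-fromFin (suc (suc (suc zero))) = refl

toFin-injective : ∀ {a b} → toFin a ≡ toFin b → a ≡ b
toFin-injective {a} {b} eq = trans (sym (fromFin-toFin a)) (trans (cong fromFin eq) (fromFin-toFin b))

_≟ᶠ_ : DecidableEquality 𝔽₄
a ≟ᶠ b = map′ toFin-injective (cong toFin) (toFin a Finₚ.≟ toFin b)

𝔽₄-elements : List 𝔽₄
𝔽₄-elements = 0# ∷ 1# ∷ ω ∷ ω² ∷ []

∈-𝔽₄-elements : ∀ a → a ∈ 𝔽₄-elements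
∈-𝔽₄-elements 0# = here refl
∈-𝔽₄-elements 1# = there (here refl)
∈-𝔽₄-elements ω  = there (there (here refl))
∈-𝔽₄-elements ω² = there (there (there (here refl)))

open Exhaustive 𝔽₄-elements ∈-𝔽₄-elements using () renaming (∀? to ∀𝔽₄?; ∃? to ∃𝔽₄?)
open Exhaustive Bool-elements ∈-Bool-elements using () renaming (∀? to ∀Bool?; ∃? to ∃Bool?)

-- Opaque, so that uses of these facts do not unfold their proofs and re-run the exhaustive checks.
opaque
  +ᶠ-identityʳ : ∀ a → a +ᶠ 0# ≡ a
  +ᶠ-identityʳ = from-yes (∀𝔽₄? λ a → (a +ᶠ 0#) ≟ᶠ a)

  +ᶠ-assoc : ∀ a b c → (a +ᶠ b) +ᶠ c ≡ a +ᶠ (b +ᶠ c)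
  +ᶠ-assoc = from-yes (∀𝔽₄? λ a → ∀𝔽₄? λ b → ∀𝔽₄? λ c → ((a +ᶠ b) +ᶠ c) ≟ᶠ (a +ᶠ (b +ᶠ c)))

  a+ᶠbc≡b+ᶠac : ∀ a b c → a +ᶠ (b +ᶠ c) ≡ b +ᶠ (a +ᶠ c)
  a+ᶠbc≡b+ᶠac = from-yes (∀𝔽₄? λ a → ∀𝔽₄? λ b → ∀𝔽₄? λ c → (a +ᶠ (b +ᶠ c)) ≟ᶠ (b +ᶠ (a +ᶠ c)))

  +ᶠ-cancelˡ : ∀ a b → a +ᶠ (a +ᶠ b) ≡ b
  +ᶠ-cancelˡ = from-yes (∀𝔽₄? λ a → ∀𝔽₄? λ b → (a +ᶠ (a +ᶠ b)) ≟ᶠ b)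

  +ᶠ-cancelʳ : ∀ a b → (a +ᶠ b) +ᶠ b ≡ a
  +ᶠ-cancelʳ = from-yes (∀𝔽₄? λ a → ∀𝔽₄? λ b → ((a +ᶠ b) +ᶠ b) ≟ᶠ a)

  colourᶠ-flip : ∀ p a s → colourᶠ (not p) (a +ᶠ s) a ≡ colourᶠ p s a
  colourᶠ-flip = from-yes
    (∀Bool? λ p → ∀𝔽₄? λ a → ∀𝔽₄? λ s → colourᶠ (not p) (a +ᶠ s) a ≟ᶠ colourᶠ p s a)

  colourᶠ-injective : ∀ p s a b → colourᶠ p s a ≡ colourᶠ p s b → a ≡ b
  colourᶠ-injective = from-yes
    (∀Bool? λ p → ∀𝔽₄? λ s → ∀𝔽₄? λ a → ∀𝔽₄? λ b → (colourᶠ p s a ≟ᶠ colourᶠ p s b) →-dec (a ≟ᶠ b))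

  colourᶠ-surjectiveʳ : ∀ p s c → ∃ λ a → colourᶠ p s a ≡ c
  colourᶠ-surjectiveʳ = from-yes
    (∀Bool? λ p → ∀𝔽₄? λ s → ∀𝔽₄? λ c → ∃𝔽₄? λ a → colourᶠ p s a ≟ᶠ c)

  colourᶠ-surjectiveˡ : ∀ p a c → ∃ λ s → colourᶠ p s a ≡ c
  colourᶠ-surjectiveˡ = from-yes
    (∀Bool? λ p → ∀𝔽₄? λ a → ∀𝔽₄? λ c → ∃𝔽₄? λ s → colourᶠ p s a ≟ᶠ c)

  colourᶠ-shift : ∀ p s e a → colourᶠ p (s +ᶠ e) a ≡ colourᶠ p s a +ᶠ ω²·ᶠ e
  colourᶠ-shift = from-yes
    (∀Bool? λ p → ∀𝔽₄? λ s → ∀𝔽₄? λ e → ∀𝔽₄? λ a → colourᶠ p (s +ᶠ e) a ≟ᶠ (colourᶠ p s a +ᶠ ω²·ᶠ e))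

  colourᶠ-twins : ∀ p α β s a → colourᶠ p (α +ᶠ (β +ᶠ s)) a ≡ colourᶠ p s a +ᶠ ω²·ᶠ (α +ᶠ β)
  colourᶠ-twins = from-yes (∀Bool? λ p → ∀𝔽₄? λ α → ∀𝔽₄? λ β → ∀𝔽₄? λ s → ∀𝔽₄? λ a →
    colourᶠ p (α +ᶠ (β +ᶠ s)) a ≟ᶠ (colourᶠ p s a +ᶠ ω²·ᶠ (α +ᶠ β)))

  -- The values form a coset of {0, ω^p (α+β)} + {0, ω² (α+β)}, which is all of 𝔽₄ because
  -- α + β ≠ 0 and ω^p ≠ ω².
  twins-reach : ∀ p u α β h → α ≢ β →
    ∃₂ λ q r → colourᶠ p u (if q then α else β) +ᶠ ω²·ᶠ ([ r ]ᶠ (α +ᶠ β)) ≡ h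
  twins-reach = from-yes
    (∀Bool? λ p → ∀𝔽₄? λ u → ∀𝔽₄? λ α → ∀𝔽₄? λ β → ∀𝔽₄? λ h → ¬? (α ≟ᶠ β) →-dec
      ∃Bool? λ q → ∃Bool? λ r → (colourᶠ p u (if q then α else β) +ᶠ ω²·ᶠ ([ r ]ᶠ (α +ᶠ β))) ≟ᶠ h)

  -- {0, α+γ} + {0, α+β} = {0, α+β, α+γ, β+γ} is all of 𝔽₄ when α, β, γ are distinct.
  triplets-reach : ∀ α β γ h c → α ≢ β → α ≢ γ → β ≢ γ →
    ∃₂ λ r s → (h +ᶠ ω²·ᶠ ([ s ]ᶠ (α +ᶠ γ))) +ᶠ ω²·ᶠ ([ r ]ᶠ (α +ᶠ β)) ≡ c
  triplets-reach = from-yes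
    (∀𝔽₄? λ α → ∀𝔽₄? λ β → ∀𝔽₄? λ γ → ∀𝔽₄? λ h → ∀𝔽₄? λ c →
      ¬? (α ≟ᶠ β) →-dec ¬? (α ≟ᶠ γ) →-dec ¬? (β ≟ᶠ γ) →-dec
      ∃Bool? λ r → ∃Bool? λ s → ((h +ᶠ ω²·ᶠ ([ s ]ᶠ (α +ᶠ γ))) +ᶠ ω²·ᶠ ([ r ]ᶠ (α +ᶠ β))) ≟ᶠ c)

𝔽₄^_ : ℕ → Set
𝔽₄^ D = Vec 𝔽₄ D

private variable
  D n : ℕ

infixl 6 _⊕_
_⊕_ : 𝔽₄^ D → 𝔽₄^ D → 𝔽₄^ D
_⊕_ = zipWith _+ᶠ_

𝟎 : 𝔽₄^ D
𝟎 = replicate _ 0#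

ω²·_ : 𝔽₄^ D → 𝔽₄^ D
ω²·_ = Vec.map ω²·ᶠ_

colour : Bool → 𝔽₄^ D → 𝔽₄^ D → 𝔽₄^ D
colour p = zipWith (colourᶠ p)

_≟ᵛ_ : DecidableEquality (𝔽₄^ D)
_≟ᵛ_ = Vecₚ.≡-dec _≟ᶠ_

⊕-identityˡ : (x : 𝔽₄^ D) → 𝟎 ⊕ x ≡ x
⊕-identityˡ []      = refl
⊕-identityˡ (a ∷ x) = cong (a ∷_) (⊕-identityˡ x)

⊕-identityʳ : (x : 𝔽₄^ D) → x ⊕ 𝟎 ≡ x
⊕-identityʳ []      = refl
⊕-identityʳ (a ∷ x) = cong₂ _∷_ (+ᶠ-identityʳ a) (⊕-identityʳ x)

⊕-assoc : (x y z : 𝔽₄^ D) → (x ⊕ y) ⊕ z ≡ x ⊕ (y ⊕ z)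
⊕-assoc []      []      []      = refl
⊕-assoc (a ∷ x) (b ∷ y) (c ∷ z) = cong₂ _∷_ (+ᶠ-assoc a b c) (⊕-assoc x y z)

x⊕yz≡y⊕xz : (x y z : 𝔽₄^ D) → x ⊕ (y ⊕ z) ≡ y ⊕ (x ⊕ z)
x⊕yz≡y⊕xz []      []      []      = refl
x⊕yz≡y⊕xz (a ∷ x) (b ∷ y) (c ∷ z) = cong₂ _∷_ (a+ᶠbc≡b+ᶠac a b c) (x⊕yz≡y⊕xz x y z)

⊕-cancelˡ : (x y : 𝔽₄^ D) → x ⊕ (x ⊕ y) ≡ y
⊕-cancelˡ []      []      = refl
⊕-cancelˡ (a ∷ x) (b ∷ y) = cong₂ _∷_ (+ᶠ-cancelˡ a b) (⊕-cancelˡ x y)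

⊕-cancelʳ : (x y : 𝔽₄^ D) → (x ⊕ y) ⊕ y ≡ x
⊕-cancelʳ []      []      = refl
⊕-cancelʳ (a ∷ x) (b ∷ y) = cong₂ _∷_ (+ᶠ-cancelʳ a b) (⊕-cancelʳ x y)

⊕-injectiveˡ : ∀ (z : 𝔽₄^ D) {x y} → x ⊕ z ≡ y ⊕ z → x ≡ y
⊕-injectiveˡ z {x} {y} eq = trans (sym (⊕-cancelʳ x z)) (trans (cong (_⊕ z) eq) (⊕-cancelʳ y z))

colour-flip : ∀ p (j s : 𝔽₄^ D) → colour (not p) (j ⊕ s) j ≡ colour p s j
colour-flip p []      []      = refl
colour-flip p (a ∷ j) (b ∷ s) = cong₂ _∷_ (colourᶠ-flip p a b) (colour-flip p j s)

colour-injective : ∀ p (s j k : 𝔽₄^ D) → colour p s j ≡ colour p s k → j ≡ k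
colour-injective p []      []      []      _  = refl
colour-injective p (b ∷ s) (a ∷ j) (c ∷ k) eq =
  cong₂ _∷_ (colourᶠ-injective p b a c (Vecₚ.∷-injectiveˡ eq)) (colour-injective p s j k (Vecₚ.∷-injectiveʳ eq))

colour-surjectiveʳ : ∀ p (s c : 𝔽₄^ D) → ∃ λ j → colour p s j ≡ c
colour-surjectiveʳ p []      []       = [] , refl
colour-surjectiveʳ p (b ∷ s) (c ∷ cs) with colourᶠ-surjectiveʳ p b c | colour-surjectiveʳ p s cs
... | a , eq | j , eqs = a ∷ j , cong₂ _∷_ eq eqs

colour-surjectiveˡ : ∀ p (j c : 𝔽₄^ D) → ∃ λ s → colour p s j ≡ c
colour-surjectiveˡ p []      []       = [] , refl
colour-surjectiveˡ p (a ∷ j) (c ∷ cs) with colourᶠ-surjectiveˡ p a c | colour-surjectiveˡ p j cs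
... | b , eq | s , eqs = b ∷ s , cong₂ _∷_ eq eqs

colour-shift : ∀ p (s e j : 𝔽₄^ D) → colour p (s ⊕ e) j ≡ colour p s j ⊕ ω²· e
colour-shift p []      []       []      = refl
colour-shift p (b ∷ s) (e ∷ es) (a ∷ j) = cong₂ _∷_ (colourᶠ-shift p b e a) (colour-shift p s es j)

colour-twins : ∀ q {α β h c} {t : 𝔽₄^ D} (s x : 𝔽₄^ suc D) → colour q s x ≡ h ∷ c →
  colour q ((α ∷ t) ⊕ ((β ∷ t) ⊕ s)) x ≡ (h +ᶠ ω²·ᶠ (α +ᶠ β)) ∷ c
colour-twins q {α} {β} {t = t} (e ∷ s) (a ∷ x) eq with Vecₚ.∷-injective eq
... | refl , refl = cong₂ _∷_ (colourᶠ-twins q α β e a) (cong (λ s → colour q s x) (⊕-cancelˡ t s))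

∷-head-tail : ∀ {A : Set} (v : Vec A (suc n)) → head v ∷ tail v ≡ v
∷-head-tail (_ ∷ _) = refl

tail-⊕ : (x y : 𝔽₄^ suc D) → tail (x ⊕ y) ≡ tail x ⊕ tail y
tail-⊕ (_ ∷ _) (_ ∷ _) = refl

tail-colour : ∀ p (s x : 𝔽₄^ suc D) → tail (colour p s x) ≡ colour p (tail s) (tail x)
tail-colour p (_ ∷ _) (_ ∷ _) = refl

length-filter-∁ : ∀ {A : Set} {P : A → Set} (P? : Decidable P) (xs : List A) →
  length (filter P? xs) + length (filter (¬? ∘ P?) xs) ≡ length xs
length-filter-∁ P? []       = refl
length-filter-∁ P? (x ∷ xs) with P? x
... | yes _ = cong suc (length-filter-∁ P? xs)
... | no  _ = trans (ℕ.+-suc _ _) (cong suc (length-filter-∁ P? xs))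

module _ {A : Set} (_≟_ : DecidableEquality A) where

  open DecMembership _≟_ using (_∈?_)

  length-≤-⊆ : ∀ {xs ys : List A} → Unique xs → xs ⊆ ys → length xs ≤ length ys
  length-≤-⊆ []                        _       = z≤n
  length-≤-⊆ {x ∷ xs} {ys} (x∉xs ∷ xs!) x∷xs⊆ys = ℕ.<-≤-trans
    (s≤s (length-≤-⊆ xs! xs⊆ys-x))
    (filter-notAll _ ys (Any.map (λ { refl x≢x → x≢x refl }) (x∷xs⊆ys (here refl))))
    where
    xs⊆ys-x : xs ⊆ filter (λ y → ¬? (x ≟ y)) ys
    xs⊆ys-x y∈xs = ∈-filter⁺ _ (x∷xs⊆ys (there y∈xs)) (All.lookup x∉xs y∈xs)

  length-≤-injection : ∀ {B : Set} {f : B → A} → (∀ {x y} → f x ≡ f y → x ≡ y) →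
    ∀ {xs ys} → Unique xs → (∀ {x} → x ∈ xs → f x ∈ ys) → length xs ≤ length ys
  length-≤-injection {f = f} f-injective {xs} {ys} xs! f∈ys =
    subst (_≤ length ys) (length-map f xs) (length-≤-⊆ (map⁺ f-injective xs!) fxs⊆ys)
    where
    fxs⊆ys : map f xs ⊆ ys
    fxs⊆ys y∈ with ∈-map⁻ f y∈
    ... | x , x∈xs , refl = f∈ys x∈xs

  large-lists-intersect : ∀ {xs ys zs : List A} → (∀ z → z ∈ zs) → Unique xs → Unique ys →
    length zs < length xs + length ys → ∃ λ z → z ∈ xs × z ∈ ys
  large-lists-intersect {xs} {ys} {zs} complete xs! ys! long with any? (_∈? ys) xs
  ... | yes common   = find common
  ... | no  disjoint = contradiction
    (length-≤-⊆ (++⁺ xs! ys! λ (z∈xs , z∈ys) → disjoint (lose z∈xs z∈ys)) (λ {z} _ → complete z))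
    (ℕ.<⇒≱ (subst (length zs <_) (sym (length-++ xs)) long))

module _ {A B : Set} (f : A → B) (_≟_ : DecidableEquality B) where

  LargeFibre : ℕ → List A → Set
  LargeFibre m S = ∃₂ λ t F → Unique F × (∀ {s} → s ∈ F → s ∈ S × f s ≡ t) × m < length F

  large-fibre : ∀ m (T : List B) {S : List A} → Unique S → (∀ {s} → s ∈ S → f s ∈ T) →
    m * length T < length S → LargeFibre m S
  large-fibre m []      {[]}    _  _   ()
  large-fibre m []      {s ∷ S} _  f∈T _ with f∈T (here refl)
  ... | ()
  large-fibre m (t ∷ T) {S}     S! f∈T long with m <? length (filter (λ s → f s ≟ t) S)
  ... | yes m<F = t , _ , filter⁺ _ S! , ∈-filter⁻ _ , m<F
  ... | no  m≮F = fibre-in-S (large-fibre m T (filter⁺ _ S!) f∈T′ long′)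
    where
    S′ : List A
    S′ = filter (λ s → ¬? (f s ≟ t)) S
    f∈T′ : ∀ {s} → s ∈ S′ → f s ∈ T
    f∈T′ s∈S′ with ∈-filter⁻ _ s∈S′
    ... | s∈S , fs≢t with f∈T s∈S
    ...   | here fs≡t  = contradiction fs≡t fs≢t
    ...   | there fs∈T = fs∈T
    long′ : m * length T < length S′
    long′ = ℕ.+-cancelˡ-< m _ _ (begin-strict
      m + m * length T                               ≡⟨ ℕ.*-suc m (length T) ⟨
      m * suc (length T)                             <⟨ long ⟩
      length S                                       ≡⟨ length-filter-∁ (λ s → f s ≟ t) S ⟨
      length (filter (λ s → f s ≟ t) S) + length S′  ≤⟨ ℕ.+-monoˡ-≤ _ (ℕ.≮⇒≥ m≮F) ⟩
      m + length S′                                  ∎)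
      where open ℕ.≤-Reasoning
    fibre-in-S : LargeFibre m S′ → LargeFibre m S
    fibre-in-S (t′ , F , F! , F⊆S′ , m<F) =
      t′ , F , F! , (λ s∈F → proj₁ (∈-filter⁻ _ (proj₁ (F⊆S′ s∈F))) , proj₂ (F⊆S′ s∈F)) , m<F

unique⇒length≤4^ : {xs : List (𝔽₄^ D)} → Unique xs → length xs ≤ 4 ^ D
unique⇒length≤4^ {D} xs! = ℕ.≤-trans (length-≤-⊆ _≟ᵛ_ xs! (λ {x} _ → ∈-vectors ∈-𝔽₄-elements x))
  (ℕ.≤-reflexive (length-vectors 𝔽₄-elements D))

translates-meet : {T : List (𝔽₄^ D)} → Unique T → 4 ^ D < length T + length T →
  ∀ z → ∃ λ a → a ∈ T × (a ⊕ z) ∈ T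
translates-meet {D} {T} T! large z
  with large-lists-intersect _≟ᵛ_ (∈-vectors ∈-𝔽₄-elements) T! (map⁺ (⊕-injectiveˡ z) T!) large′
  where
  large′ : length (vectors 𝔽₄-elements D) < length T + length (map (_⊕ z) T)
  large′ = subst₂ (λ m k → m < length T + k) (sym (length-vectors 𝔽₄-elements D)) (sym (length-map (_⊕ z) T)) large
... | w , w∈T , w∈T⊕z with ∈-map⁻ (_⊕ z) w∈T⊕z
...   | a , a∈T , refl = a , a∈T , w∈T

-- Large sets of directions reach every colour

parity : ∀ {A : Set} → List A → Bool
parity []      = false
parity (_ ∷ l) = not (parity l)

parity-map : ∀ {A B : Set} (f : A → B) (l : List A) → parity (map f l) ≡ parity l
parity-map f []      = refl
parity-map f (x ∷ l) = cong not (parity-map f l)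

∑ : List (𝔽₄^ D) → 𝔽₄^ D
∑ = foldr _⊕_ 𝟎

tail-∑ : (l : List (𝔽₄^ suc D)) → tail (∑ l) ≡ ∑ (map tail l)
tail-∑ []      = refl
tail-∑ (x ∷ l) = trans (tail-⊕ x (∑ l)) (cong (tail x ⊕_) (tail-∑ l))

-- The colour of the edge in direction x at the vertex obtained by toggling the coordinates l
-- (repetitions allowed) of a vertex of weight parity p and index sum 0.
toggledColour : Bool → List (𝔽₄^ D) → 𝔽₄^ D → 𝔽₄^ D
toggledColour p l x = colour (parity l xor p) (∑ l) x

Covers : List (𝔽₄^ D) → Set
Covers S = ∀ p c → ∃₂ λ l x → All (_∈ S) l × x ∈ S × toggledColour p l x ≡ c

tail-toggledColour : ∀ p l (x : 𝔽₄^ suc D) →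
  tail (toggledColour p l x) ≡ toggledColour p (map tail l) (tail x)
tail-toggledColour p l x = trans (tail-colour (parity l xor p) (∑ l) x)
  (cong₂ (λ q s → colour (q xor p) s (tail x)) (sym (parity-map tail l)) (tail-∑ l))

twinIf : ∀ {A : Set} → Bool → A → A → List A → List A
twinIf false u v l = l
twinIf true  u v l = u ∷ v ∷ l

All-twinIf : ∀ {A : Set} {P : A → Set} r {u v l} → P u → P v → All P l → All P (twinIf r u v l)
All-twinIf false pu pv pl = pl
All-twinIf true  pu pv pl = pu ∷ pv ∷ pl

toggledColour-twinIf : ∀ p r {α β h c} {t : 𝔽₄^ D} l x → toggledColour p l x ≡ h ∷ c →
  toggledColour p (twinIf r (α ∷ t) (β ∷ t) l) x ≡ (h +ᶠ ω²·ᶠ ([ r ]ᶠ (α +ᶠ β))) ∷ c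
toggledColour-twinIf p false l x eq = trans eq (cong (_∷ _) (sym (+ᶠ-identityʳ _)))
toggledColour-twinIf p true  l x eq rewrite not-involutive (parity l) =
  colour-twins (parity l xor p) (∑ l) x eq

tails : List (𝔽₄^ suc D) → List (𝔽₄^ D)
tails S = deduplicate _≟ᵛ_ (map tail S)

∈-column : ∀ {s : 𝔽₄^ suc D} {t} → tail s ≡ t → s ∈ map (_∷ t) 𝔽₄-elements
∈-column {s = a ∷ _} refl = ∈-map⁺ (_∷ _) (∈-𝔽₄-elements a)

module _ {D} {S : List (𝔽₄^ suc D)} where

  tails! : Unique (tails S)
  tails! = deduplicate-! _≟ᵛ_ (map tail S)

  ∈-tails⁺ : ∀ {s} → s ∈ S → tail s ∈ tails S
  ∈-tails⁺ s∈S = ∈-deduplicate⁺ _≟ᵛ_ (∈-map⁺ tail s∈S)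

  ∈-tails⁻ : ∀ {t} → t ∈ tails S → ∃ λ a → (a ∷ t) ∈ S
  ∈-tails⁻ t∈T with ∈-map⁻ tail (∈-deduplicate⁻ _≟ᵛ_ (map tail S) t∈T)
  ... | (a ∷ _) , s∈S , refl = a , s∈S

  lift-tails : ∀ {l} → All (_∈ tails S) l → ∃ λ l′ → All (_∈ S) l′ × map tail l′ ≡ l
  lift-tails []          = [] , [] , refl
  lift-tails (t∈T ∷ l⊆T) with ∈-tails⁻ t∈T | lift-tails l⊆T
  ... | a , s∈S | l′ , l′⊆S , refl = (a ∷ _) ∷ l′ , s∈S ∷ l′⊆S , refl

  module _ (S! : Unique S) where

    private
      fibre : ∀ m → m * length (tails S) < length S → LargeFibre tail _≟ᵛ_ m S
      fibre m = large-fibre tail _≟ᵛ_ m (tails S) S! ∈-tails⁺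

    length-≤-4*tails : length S ≤ 4 * length (tails S)
    length-≤-4*tails = ℕ.≮⇒≥ λ long → small-fibre (fibre 4 long)
      where
      small-fibre : ¬ LargeFibre tail _≟ᵛ_ 4 S
      small-fibre (t , F , F! , F⊆ , 4<F) =
        ℕ.<⇒≱ 4<F (length-≤-⊆ _≟ᵛ_ F! (λ s∈F → ∈-column (proj₂ (F⊆ s∈F))))

    twins : length (tails S) < length S →
      ∃₂ λ α β → ∃ λ t → α ≢ β × (α ∷ t) ∈ S × (β ∷ t) ∈ S
    twins long with fibre 1 (subst (_< length S) (sym (ℕ.*-identityˡ _)) long)
    ... | t , (α ∷ _) ∷ (β ∷ _) ∷ _ , (x≢y ∷ _) ∷ _ , F⊆ , _
        with F⊆ (here refl) | F⊆ (there (here refl))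
    ...   | x∈S , refl | y∈S , refl = α , β , t , (λ { refl → x≢y refl }) , x∈S , y∈S
    twins long | _ , []     , _ , _ , ()
    twins long | _ , _ ∷ [] , _ , _ , s≤s ()

    triplets : length (tails S) + length (tails S) < length S →
      ∃₂ λ α β → ∃₂ λ γ t → α ≢ β × α ≢ γ × β ≢ γ × (α ∷ t) ∈ S × (β ∷ t) ∈ S × (γ ∷ t) ∈ S
    triplets long with fibre 2 (subst (_< length S) (cong (length (tails S) +_) (sym (ℕ.+-identityʳ _))) long)
    ... | t , (α ∷ _) ∷ (β ∷ _) ∷ (γ ∷ _) ∷ _ , (x≢y ∷ x≢z ∷ _) ∷ (y≢z ∷ _) ∷ _ , F⊆ , _
        with F⊆ (here refl) | F⊆ (there (here refl)) | F⊆ (there (there (here refl)))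
    ...   | x∈S , refl | y∈S , refl | z∈S , refl =
      α , β , γ , t , (λ { refl → x≢y refl }) , (λ { refl → x≢z refl }) , (λ { refl → y≢z refl }) ,
      x∈S , y∈S , z∈S
    triplets long | _ , []         , _ , _ , ()
    triplets long | _ , _ ∷ []     , _ , _ , s≤s ()
    triplets long | _ , _ ∷ _ ∷ [] , _ , _ , s≤s (s≤s ())

    covers-when-tails-many : 4 ^ D < length S → 4 ^ D < length (tails S) + length (tails S) → Covers S
    covers-when-tails-many long many p (hc ∷ tc)
      with twins (ℕ.≤-<-trans (unique⇒length≤4^ tails!) long)
    ... | α , β , t , α≢β , x∈S , y∈S
      with colour-surjectiveˡ p t tc
    ... | z , tail-ok
      with translates-meet tails! many z
    ... | a , a∈T , a⊕z∈T
      with ∈-tails⁻ a∈T | ∈-tails⁻ a⊕z∈T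
    ... | hA , A∈S | hB , B∈S
      with twins-reach p (hA +ᶠ (hB +ᶠ 0#)) α β hc α≢β
    ... | q , r , head-ok =
      twinIf r (α ∷ t) (β ∷ t) anchors , direction q ,
      All-twinIf r x∈S y∈S (A∈S ∷ B∈S ∷ []) , direction∈S q ,
      trans (toggledColour-twinIf p r anchors (direction q) anchors-colour) (cong (_∷ tc) head-ok)
      where
      anchors : List (𝔽₄^ suc D)
      anchors = (hA ∷ a) ∷ (hB ∷ (a ⊕ z)) ∷ []
      direction : Bool → 𝔽₄^ suc D
      direction q = (if q then α else β) ∷ t
      direction∈S : ∀ q → direction q ∈ S
      direction∈S true  = x∈S
      direction∈S false = y∈S
      anchors-colour : toggledColour p anchors (direction q) ≡ colourᶠ p (hA +ᶠ (hB +ᶠ 0#)) (if q then α else β) ∷ tc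
      anchors-colour = cong (_ ∷_) (trans
        (cong (λ s → colour p s t) (trans (cong (a ⊕_) (⊕-identityʳ (a ⊕ z))) (⊕-cancelˡ a z)))
        tail-ok)

    covers-when-tails-few : 4 ^ D < length S → length (tails S) + length (tails S) ≤ 4 ^ D →
      Covers (tails S) → Covers S
    covers-when-tails-few long few covers-tails p (hc ∷ tc)
      with triplets (ℕ.≤-<-trans few long)
    ... | α , β , γ , t , α≢β , α≢γ , β≢γ , x∈S , y∈S , z∈S
      with covers-tails p tc
    ... | l₀ , x₀ , l₀⊆T , x₀∈T , tail-ok
      with lift-tails l₀⊆T | ∈-tails⁻ x₀∈T
    ... | l , l⊆S , refl | h₀ , h₀∷x₀∈S
      with triplets-reach α β γ (head (toggledColour p l (h₀ ∷ x₀))) hc α≢β α≢γ β≢γ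
    ... | r , s , head-ok =
      twinIf r (α ∷ t) (β ∷ t) (twinIf s (α ∷ t) (γ ∷ t) l) , h₀ ∷ x₀ ,
      All-twinIf r x∈S y∈S (All-twinIf s x∈S z∈S l⊆S) , h₀∷x₀∈S ,
      trans (toggledColour-twinIf p r _ _ (toggledColour-twinIf p s l _ lifted-colour)) (cong (_∷ tc) head-ok)
      where
      lifted-colour : toggledColour p l (h₀ ∷ x₀) ≡ head (toggledColour p l (h₀ ∷ x₀)) ∷ tc
      lifted-colour = trans (sym (∷-head-tail _)) (cong (_ ∷_) (trans (tail-toggledColour p l (h₀ ∷ x₀)) tail-ok))

large-sets-cover : ∀ D {S : List (𝔽₄^ D)} → Unique S → 4 ^ D < 4 * length S → Covers S
large-sets-cover zero    {[] ∷ _} _  _    p [] = [] , [] , [] , here refl , refl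
large-sets-cover (suc D) {S}      S! long with 4 ^ D <? length (tails S) + length (tails S)
... | yes many = covers-when-tails-many S! (ℕ.*-cancelˡ-< 4 _ _ long) many
... | no  few  = covers-when-tails-few S! (ℕ.*-cancelˡ-< 4 _ _ long) (ℕ.≮⇒≥ few)
  (large-sets-cover D tails! (ℕ.<-≤-trans (ℕ.*-cancelˡ-< 4 _ _ long) (length-≤-4*tails S!)))

weightParity : Vertex n → Bool
weightParity []      = false
weightParity (b ∷ x) = b xor weightParity x

indexSum : (Fin n → 𝔽₄^ D) → Vertex n → 𝔽₄^ D
indexSum f []      = 𝟎
indexSum f (b ∷ x) = if b then f zero ⊕ indexSum (f ∘ suc) x else indexSum (f ∘ suc) x

lookup-flipAt : ∀ (x : Vertex n) j → lookup (flipAt x j) j ≡ not (lookup x j)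
lookup-flipAt x j = Vecₚ.[]=⇒lookup (Vecₚ.updateAt-updates j x (Vecₚ.lookup⇒[]= j x refl))

lookup-flipAt-≢ : ∀ (x : Vertex n) {i j} → i ≢ j → lookup (flipAt x j) i ≡ lookup x i
lookup-flipAt-≢ x {i} {j} i≢j = Vecₚ.[]=⇒lookup (Vecₚ.updateAt-minimal i j x i≢j (Vecₚ.lookup⇒[]= i x refl))

flipAt-involutive : ∀ (x : Vertex n) j → flipAt (flipAt x j) j ≡ x
flipAt-involutive x j = trans (Vecₚ.updateAt-updateAt-local j x (not-involutive (lookup x j))) (Vecₚ.updateAt-id j x)

weightParity-flipAt : ∀ (x : Vertex n) j → weightParity (flipAt x j) ≡ not (weightParity x)
weightParity-flipAt (b ∷ x) zero    = sym (not-distribˡ-xor b (weightParity x))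
weightParity-flipAt (b ∷ x) (suc j) =
  trans (cong (b xor_) (weightParity-flipAt x j)) (sym (not-distribʳ-xor b (weightParity x)))

indexSum-flipAt : ∀ (f : Fin n → 𝔽₄^ D) x j → indexSum f (flipAt x j) ≡ f j ⊕ indexSum f x
indexSum-flipAt f (true  ∷ x) zero    = sym (⊕-cancelˡ (f zero) _)
indexSum-flipAt f (false ∷ x) zero    = refl
indexSum-flipAt f (true  ∷ x) (suc j) =
  trans (cong (f zero ⊕_) (indexSum-flipAt (f ∘ suc) x j)) (x⊕yz≡y⊕xz (f zero) (f (suc j)) _)
indexSum-flipAt f (false ∷ x) (suc j) = indexSum-flipAt (f ∘ suc) x j

toggles : Vertex n → List (Fin n) → Vertex n
toggles x []       = x
toggles x (j ∷ js) = flipAt (toggles x js) j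

weightParity-toggles : ∀ (x : Vertex n) js → weightParity (toggles x js) ≡ parity js xor weightParity x
weightParity-toggles x []       = refl
weightParity-toggles x (j ∷ js) = trans (weightParity-flipAt (toggles x js) j)
  (trans (cong not (weightParity-toggles x js)) (not-distribˡ-xor (parity js) (weightParity x)))

indexSum-toggles : ∀ (f : Fin n → 𝔽₄^ D) x js → indexSum f (toggles x js) ≡ ∑ (map f js) ⊕ indexSum f x
indexSum-toggles f x []       = sym (⊕-identityˡ (indexSum f x))
indexSum-toggles f x (j ∷ js) = trans (indexSum-flipAt f (toggles x js) j)
  (trans (cong (f j ⊕_) (indexSum-toggles f x js)) (sym (⊕-assoc (f j) _ _)))

toggles-∈Cube : ∀ {k} (C : Subcube n k) {js} → All (Subset._∈ Subcube.free C) js →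
  toggles (Subcube.base C) js ∈Cube C
toggles-∈Cube C []                                  i i∉free = refl
toggles-∈Cube C {j ∷ js} (j∈free ∷ js∈free) i i∉free =
  trans (lookup-flipAt-≢ (toggles (Subcube.base C) js) {i} {j} λ { refl → i∉free j∈free })
        (toggles-∈Cube C js∈free i i∉free)

lowEnd : Vertex n → Fin n → Vertex n
lowEnd x j = if lookup x j then flipAt x j else x

lookup-lowEnd : ∀ (x : Vertex n) j → lookup (lowEnd x j) j ≡ false
lookup-lowEnd x j with lookup x j in eq
... | false = eq
... | true  = trans (lookup-flipAt x j) (cong not eq)

lowEnd-false : ∀ {x : Vertex n} {j} → lookup x j ≡ false → lowEnd x j ≡ x
lowEnd-false {x = x} {j} eq = cong (if_then flipAt x j else x) eq

lowEnd-true : ∀ {x : Vertex n} {j} → lookup x j ≡ true → lowEnd x j ≡ flipAt x j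
lowEnd-true {x = x} {j} eq = cong (if_then flipAt x j else x) eq

edgeAt : Vertex n → Fin n → Edge n
edgeAt x j = edge (lowEnd x j) j (lookup-lowEnd x j)

edge-≡ : ∀ {e f : Edge n} → low e ≡ low f → dir e ≡ dir f → e ≡ f
edge-≡ {e = edge x j p} {edge .x .j q} refl refl = cong (edge x j) (Decidable⇒UIP.≡-irrelevant Bool._≟_ p q)

endpoint-edgeAt : ∀ (x : Vertex n) j → x isEndpointOf edgeAt x j
endpoint-edgeAt x j with lookup x j
... | false = inj₁ refl
... | true  = inj₂ (sym (flipAt-involutive x j))

edgeAt-endpoint : ∀ {x : Vertex n} e → x isEndpointOf e → edgeAt x (dir e) ≡ e
edgeAt-endpoint (edge x j p) (inj₁ refl) = edge-≡ (lowEnd-false p) refl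
edgeAt-endpoint (edge x j p) (inj₂ refl) =
  edge-≡ (trans (lowEnd-true (trans (lookup-flipAt x j) (cong not p))) (flipAt-involutive x j)) refl

edgeAt-⊆Cube : ∀ {k} {C : Subcube n k} x j → x ∈Cube C → flipAt x j ∈Cube C → edgeAt x j ⊆Cube C
edgeAt-⊆Cube {C = C} x j x∈C x′∈C with lookup x j
... | false = x∈C , x′∈C
... | true  = x′∈C , subst (_∈Cube C) (sym (flipAt-involutive x j)) x∈C

members : Subset.Subset n → List (Fin n)
members []          = []
members (true  ∷ p) = zero ∷ map suc (members p)
members (false ∷ p) = map suc (members p)

members! : (p : Subset.Subset n) → Unique (members p)
members! []          = []
members! (true  ∷ p) = Allₚ.map⁺ (All.universal (λ _ ()) (members p)) ∷ map⁺ Finₚ.suc-injective (members! p)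
members! (false ∷ p) = map⁺ Finₚ.suc-injective (members! p)

length-members : (p : Subset.Subset n) → length (members p) ≡ Subset.∣ p ∣
length-members []          = refl
length-members (true  ∷ p) = cong suc (trans (length-map suc (members p)) (length-members p))
length-members (false ∷ p) = trans (length-map suc (members p)) (length-members p)

∈-members⁻ : ∀ (p : Subset.Subset n) {i} → i ∈ members p → i Subset.∈ p
∈-members⁻ (true  ∷ p) (here refl) = Vec.here
∈-members⁻ (true  ∷ p) (there i∈) with ∈-map⁻ suc i∈
... | i , i∈p , refl = Vec.there (∈-members⁻ p i∈p)
∈-members⁻ (false ∷ p) i∈ with ∈-map⁻ suc i∈
... | i , i∈p , refl = Vec.there (∈-members⁻ p i∈p)

-- Indexing the coordinates by 𝔽₄^D

encode : ∀ D → Fin (4 ^ D) → 𝔽₄^ D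
encode zero    _ = []
encode (suc D) i = fromFin (proj₁ (Fin.remQuot {4} (4 ^ D) i)) ∷ encode D (proj₂ (Fin.remQuot {4} (4 ^ D) i))

decode : 𝔽₄^ D → Fin (4 ^ D)
decode []      = zero
decode (a ∷ v) = Fin.combine (toFin a) (decode v)

encode-decode : (v : 𝔽₄^ D) → encode D (decode v) ≡ v
encode-decode []              = refl
encode-decode {suc D} (a ∷ v) =
  trans (cong (λ (b , j) → fromFin b ∷ encode D j) (Finₚ.remQuot-combine (toFin a) (decode v)))
        (cong₂ _∷_ (fromFin-toFin a) (encode-decode v))

decode-encode : ∀ D (i : Fin (4 ^ D)) → decode (encode D i) ≡ i
decode-encode zero    zero = refl
decode-encode (suc D) i    = trans
  (cong₂ (Fin.combine {4} {4 ^ D}) (toFin-fromFin (proj₁ (Fin.remQuot {4} (4 ^ D) i)))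
                                   (decode-encode D (proj₂ (Fin.remQuot {4} (4 ^ D) i))))
  (Finₚ.combine-remQuot {4} (4 ^ D) i)

encode-injective : ∀ D {i j : Fin (4 ^ D)} → encode D i ≡ encode D j → i ≡ j
encode-injective D {i} {j} eq = trans (sym (decode-encode D i)) (trans (cong decode eq) (decode-encode D j))

-- The colouring of Q_(4^D)

module Colouring (D : ℕ) where

  N : ℕ
  N = 4 ^ D

  vertexColour : Vertex N → Fin N → 𝔽₄^ D
  vertexColour x j = colour (weightParity x) (indexSum (encode D) x) (encode D j)

  vertexColour-flipAt : ∀ x j → vertexColour (flipAt x j) j ≡ vertexColour x j
  vertexColour-flipAt x j = trans
    (cong₂ (λ p s → colour p s (encode D j)) (weightParity-flipAt x j) (indexSum-flipAt (encode D) x j))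
    (colour-flip (weightParity x) (encode D j) (indexSum (encode D) x))

  vertexColour-injective : ∀ x {j k} → vertexColour x j ≡ vertexColour x k → j ≡ k
  vertexColour-injective x {j} {k} eq =
    encode-injective D (colour-injective (weightParity x) (indexSum (encode D) x) (encode D j) (encode D k) eq)

  directionOf : Vertex N → 𝔽₄^ D → Fin N
  directionOf x γ = decode (proj₁ (colour-surjectiveʳ (weightParity x) (indexSum (encode D) x) γ))

  vertexColour-directionOf : ∀ x γ → vertexColour x (directionOf x γ) ≡ γ
  vertexColour-directionOf x γ = trans
    (cong (colour (weightParity x) (indexSum (encode D) x)) (encode-decode _))
    (proj₂ (colour-surjectiveʳ (weightParity x) (indexSum (encode D) x) γ))

  directionOf-unique : ∀ x {j γ} → vertexColour x j ≡ γ → directionOf x γ ≡ j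
  directionOf-unique x eq = vertexColour-injective x (trans (vertexColour-directionOf x _) (sym eq))

  edgeColour : Edge N → 𝔽₄^ D
  edgeColour e = vertexColour (low e) (dir e)

  edgeColour-endpoint : ∀ {x} e → x isEndpointOf e → edgeColour e ≡ vertexColour x (dir e)
  edgeColour-endpoint e (inj₁ refl) = refl
  edgeColour-endpoint e (inj₂ refl) = sym (vertexColour-flipAt (low e) (dir e))

  edgeColour-edgeAt : ∀ x j → edgeColour (edgeAt x j) ≡ vertexColour x j
  edgeColour-edgeAt x j = edgeColour-endpoint (edgeAt x j) (endpoint-edgeAt x j)

  vertexColour-toggles : ∀ b l g → vertexColour (toggles b (map decode l)) (decode g) ≡
                                    toggledColour (weightParity b) l g ⊕ ω²· indexSum (encode D) b
  vertexColour-toggles b l g = begin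
    colour (weightParity y) (indexSum (encode D) y) (encode D (decode g))
      ≡⟨ cong₂ (λ q s → colour q s (encode D (decode g)))
               (weightParity-toggles b js) (indexSum-toggles (encode D) b js) ⟩
    colour (parity js xor p) (∑ (map (encode D) js) ⊕ σ) (encode D (decode g))
      ≡⟨ cong₂ (λ q s → colour (q xor p) s (encode D (decode g)))
               (parity-map decode l) (cong (λ l′ → ∑ l′ ⊕ σ) encode-js) ⟩
    colour (parity l xor p) (∑ l ⊕ σ) (encode D (decode g))
      ≡⟨ cong (colour (parity l xor p) (∑ l ⊕ σ)) (encode-decode g) ⟩
    colour (parity l xor p) (∑ l ⊕ σ) g
      ≡⟨ colour-shift (parity l xor p) (∑ l) σ g ⟩
    toggledColour p l g ⊕ ω²· σ ∎
    where
    open ≡-Reasoning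
    p : Bool
    p = weightParity b
    σ : 𝔽₄^ D
    σ = indexSum (encode D) b
    js : List (Fin N)
    js = map decode l
    y : Vertex N
    y = toggles b js
    encode-js : map (encode D) js ≡ l
    encode-js = trans (sym (map-∘ l)) (trans (map-cong encode-decode l) (map-id l))

  subcube-has-colour : ∀ {k} (C : Subcube N k) → 4 ^ D < 4 * k → ∀ γ → ∃ λ e → edgeColour e ≡ γ × e ⊆Cube C
  subcube-has-colour C@(subcube free |free| b) large γ
    with large-sets-cover D (map⁺ (encode-injective D) (members! free)) large′
                          (weightParity b) (γ ⊕ ω²· indexSum (encode D) b)
    where
    large′ : 4 ^ D < 4 * length (map (encode D) (members free))
    large′ = subst (λ m → 4 ^ D < 4 * m)
      (sym (trans (length-map (encode D) (members free)) (trans (length-members free) |free|))) large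
  ... | l , g , l⊆S , g∈S , colour-ok =
    edgeAt y (decode g) ,
    trans (edgeColour-edgeAt y (decode g)) (trans (vertexColour-toggles b l g)
      (trans (cong (_⊕ ω²· indexSum (encode D) b) colour-ok) (⊕-cancelʳ γ _))) ,
    edgeAt-⊆Cube {C = C} y (decode g) (toggles-∈Cube C js∈free) (toggles-∈Cube C (decode∈free g∈S ∷ js∈free))
    where
    y : Vertex N
    y = toggles b (map decode l)
    decode∈free : ∀ {v} → v ∈ map (encode D) (members free) → decode v Subset.∈ free
    decode∈free v∈S with ∈-map⁻ (encode D) v∈S
    ... | i , i∈free , refl = subst (Subset._∈ free) (sym (decode-encode D i)) (∈-members⁻ free i∈free)
    js∈free : All (Subset._∈ free) (map decode l)
    js∈free = Allₚ.map⁺ (All.map decode∈free l⊆S)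

  allVertices : List (Vertex N)
  allVertices = vectors Bool-elements N

  allVertices! : Unique allVertices
  allVertices! = vectors⁺ Bool-elements! N

  _≟ⱽ_ : DecidableEquality (Vertex N)
  _≟ⱽ_ = Vecₚ.≡-dec Bool._≟_

  module _ (γ : 𝔽₄^ D) where

    isLow? : Decidable (λ x → lookup x (directionOf x γ) ≡ false)
    isLow? x = lookup x (directionOf x γ) Bool.≟ false

    lowVertices : List (Vertex N)
    lowVertices = filter isLow? allVertices

    highVertices : List (Vertex N)
    highVertices = filter (¬? ∘ isLow?) allVertices

    colourClass : List (Edge N)
    colourClass = map (λ x → edgeAt x (directionOf x γ)) lowVertices

    ∈-colourClass⁺ : ∀ e → edgeColour e ≡ γ → e ∈ colourClass
    ∈-colourClass⁺ e eq = subst (_∈ colourClass) edgeAt-low (∈-map⁺ _ low∈lowVertices)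
      where
      direction≡ : directionOf (low e) γ ≡ dir e
      direction≡ = directionOf-unique (low e) eq
      low∈lowVertices : low e ∈ lowVertices
      low∈lowVertices = ∈-filter⁺ isLow? (∈-vectors ∈-Bool-elements (low e))
        (trans (cong (lookup (low e)) direction≡) (lowDir e))
      edgeAt-low : edgeAt (low e) (directionOf (low e) γ) ≡ e
      edgeAt-low = trans (cong (edgeAt (low e)) direction≡) (edgeAt-endpoint e (inj₁ refl))

    ∈-colourClass⁻ : ∀ {e} → e ∈ colourClass → edgeColour e ≡ γ
    ∈-colourClass⁻ e∈ with ∈-map⁻ _ e∈
    ... | x , _ , refl = trans (edgeColour-edgeAt x _) (vertexColour-directionOf x γ)

    low-colourClass : map low colourClass ≡ lowVertices
    low-colourClass = trans (sym (map-∘ lowVertices))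
      (map-id-local (All.tabulate λ x∈ → lowEnd-false (proj₂ (∈-filter⁻ isLow? {xs = allVertices} x∈))))

    colourClass-matching : IsMatching colourClass
    colourClass-matching = map⁻ (subst Unique (sym low-colourClass) (filter⁺ isLow? allVertices!)) , disjoint
      where
      colour-at : ∀ {v e} → e ∈ colourClass → v isEndpointOf e → vertexColour v (dir e) ≡ γ
      colour-at {e = e} e∈ v∈e = trans (sym (edgeColour-endpoint e v∈e)) (∈-colourClass⁻ e∈)
      disjoint : ∀ e f → e ∈ colourClass → f ∈ colourClass → e ≢ f → ∀ v → v isEndpointOf e → ¬ (v isEndpointOf f)
      disjoint e f e∈ f∈ e≢f v v∈e v∈f = e≢f (begin
        e                ≡⟨ edgeAt-endpoint e v∈e ⟨
        edgeAt v (dir e) ≡⟨ cong (edgeAt v) (vertexColour-injective v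
                                (trans (colour-at e∈ v∈e) (sym (colour-at f∈ v∈f)))) ⟩
        edgeAt v (dir f) ≡⟨ edgeAt-endpoint f v∈f ⟩
        f                ∎)
        where open ≡-Reasoning

    colourClass-pairingStrategy : ∀ {k} → 4 ^ D < 4 * k → IsPairingStrategy N k colourClass
    colourClass-pairingStrategy large = colourClass-matching , λ C → edge-in-class C (subcube-has-colour C large γ)
      where
      edge-in-class : ∀ {k} (C : Subcube N k) →
        (∃ λ e → edgeColour e ≡ γ × e ⊆Cube C) → ∃ λ e → e ∈ colourClass × e ⊆Cube C
      edge-in-class C (e , colour≡ , e⊆C) = e , ∈-colourClass⁺ e colour≡ , e⊆C

    partner : Vertex N → Vertex N
    partner x = flipAt x (directionOf x γ)

    directionOf-partner : ∀ x → directionOf (partner x) γ ≡ directionOf x γ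
    directionOf-partner x =
      directionOf-unique (partner x) (trans (vertexColour-flipAt x _) (vertexColour-directionOf x γ))

    partner-involutive : ∀ x → partner (partner x) ≡ x
    partner-involutive x = trans (cong (flipAt (partner x)) (directionOf-partner x)) (flipAt-involutive x _)

    partner-injective : ∀ {x y} → partner x ≡ partner y → x ≡ y
    partner-injective {x} {y} eq = trans (sym (partner-involutive x)) (trans (cong partner eq) (partner-involutive y))

    lookup-partner : ∀ x → lookup (partner x) (directionOf (partner x) γ) ≡ not (lookup x (directionOf x γ))
    lookup-partner x = trans (cong (lookup (partner x)) (directionOf-partner x)) (lookup-flipAt x _)

    length-lowVertices : length lowVertices ≡ length highVertices
    length-lowVertices = ℕ.≤-antisym
      (length-≤-injection _≟ⱽ_ partner-injective (filter⁺ isLow? allVertices!) low→high)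
      (length-≤-injection _≟ⱽ_ partner-injective (filter⁺ (¬? ∘ isLow?) allVertices!) high→low)
      where
      low→high : ∀ {x} → x ∈ lowVertices → partner x ∈ highVertices
      low→high {x} x∈ = ∈-filter⁺ (¬? ∘ isLow?) (∈-vectors ∈-Bool-elements (partner x)) λ partner-low →
        case trans (sym partner-low) (trans (lookup-partner x)
                   (cong not (proj₂ (∈-filter⁻ isLow? {xs = allVertices} x∈)))) of λ ()
      high→low : ∀ {x} → x ∈ highVertices → partner x ∈ lowVertices
      high→low {x} x∈ = ∈-filter⁺ isLow? (∈-vectors ∈-Bool-elements (partner x))
        (trans (lookup-partner x) (cong not (¬-not (proj₂ (∈-filter⁻ (¬? ∘ isLow?) {xs = allVertices} x∈)))))

    length-colourClass : 2 * length colourClass ≡ 2 ^ N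
    length-colourClass = begin
      2 * length colourClass                         ≡⟨ cong (λ m → m + (m + 0)) (length-map _ lowVertices) ⟩
      length lowVertices + (length lowVertices + 0)  ≡⟨ cong (length lowVertices +_) (ℕ.+-identityʳ _) ⟩
      length lowVertices + length lowVertices        ≡⟨ cong (length lowVertices +_) length-lowVertices ⟩
      length lowVertices + length highVertices       ≡⟨ length-filter-∁ isLow? allVertices ⟩
      length allVertices                             ≡⟨ length-vectors Bool-elements N ⟩
      2 ^ N                                          ∎
      where open ≡-Reasoning

colourClasses-partition : ∀ D k → 4 ^ D < 4 * k →
  Σ (Fin (4 ^ D) → List (Edge (4 ^ D))) λ M →
    (∀ j → IsPairingStrategy (4 ^ D) k (M j)) ×
    (∀ j j′ → j ≢ j′ → ∀ e → e ∈ M j → ¬ (e ∈ M j′)) ×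
    (∀ j j′ → length (M j) ≡ length (M j′)) ×
    (∀ (e : Edge (4 ^ D)) → ∃ λ j → e ∈ M j)
colourClasses-partition D k large = M , strategy , disjoint , equal-length , covering
  where
  open Colouring D
  M : Fin N → List (Edge N)
  M j = colourClass (encode D j)
  strategy : ∀ j → IsPairingStrategy N k (M j)
  strategy j = colourClass-pairingStrategy (encode D j) large
  disjoint : ∀ j j′ → j ≢ j′ → ∀ e → e ∈ M j → ¬ (e ∈ M j′)
  disjoint j j′ j≢j′ e e∈ e∈′ = j≢j′ (encode-injective D (trans (sym (∈-colourClass⁻ _ e∈)) (∈-colourClass⁻ _ e∈′)))
  equal-length : ∀ j j′ → length (M j) ≡ length (M j′)
  equal-length j j′ = ℕ.*-cancelˡ-≡ _ _ 2 (trans (length-colourClass _) (sym (length-colourClass _)))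
  covering : ∀ e → ∃ λ j → e ∈ M j
  covering e = decode (edgeColour e) , ∈-colourClass⁺ _ e (sym (encode-decode _))

theorem5 : (d : ℕ) →
    Σ (Fin (4 ^ (d + 1)) → List (Edge (4 ^ (d + 1)))) λ M →
      (∀ j → IsPairingStrategy (4 ^ (d + 1)) (4 ^ d + 1) (M j)) ×
      (∀ j j' → j ≢ j' → ∀ e → e ∈ M j → ¬ (e ∈ M j')) ×
      (∀ j j' → length (M j) ≡ length (M j')) ×
      (∀ (e : Edge (4 ^ (d + 1))) → ∃ λ j → e ∈ M j)
theorem5 d = colourClasses-partition (d + 1) (4 ^ d + 1) (begin-strict
  4 ^ (d + 1)     ≡⟨ cong (4 ^_) (ℕ.+-comm d 1) ⟩
  4 * 4 ^ d       <⟨ ℕ.*-monoʳ-< 4 (ℕ.m<m+n (4 ^ d) (s≤s z≤n)) ⟩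
  4 * (4 ^ d + 1) ∎)
  where open ℕ.≤-Reasoning
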